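{- Let $G$ be a graph with two threshold functions $\tau,\tau':V(G)\to\mathbb{N}$ such that $\tau'(v)\le\tau(v)-1$ for every vertex $v$ of $G$. Then $dyn_{\tau'}(G)\le dyn_\tau(G)-1$.
   Context: For a graph $G$ with threshold assignment $\tau:V(G)\to\mathbb{N}$ ($\tau(v)\le d_G(v)$), a set $D\subseteq V(G)$ is a $\tau$-dynamic monopoly if $V(G)$ can be partitioned into $D_0=D,D_1,\dots,D_k$ such that each $v\in D_{i+1}$ has at least $\tau(v)$ neighbors in $D_0\cup\dots\cup D_i$. $dyn_\tau(G)$ is the minimum size of a $\tau$-dynamic monopoly. -}

module Defs where

open import Data.Nat using (ℕ; zero; suc; _+_; _≤_; _<ᵇ_)
open import Data.Bool using (Bool; true; false; _∧_)
open import Data.Fin using (Fin; toℕ)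
open import Data.Fin.Subset using (Subset; ∣_∣)
open import Data.Vec using (lookup)
open import Data.Product using (Σ; _×_; ∃)
open import Relation.Binary.PropositionalEquality using (_≡_)
open import Function.Bundles using (_⇔_)
open import Data.Sum using (_⊎_)

record Graph (n : ℕ) : Set where
  field
    adj   : Fin n → Fin n → Bool
    sym   : ∀ u v → adj u v ≡ adj v u
    loopless : ∀ v → adj v v ≡ false
open Graph public

count : ∀ {n} → (Fin n → Bool) → ℕ
count {zero}  p = 0
count {suc n} p with p Fin.zero
... | true  = suc (count (λ i → p (Fin.suc i)))
... | false = count (λ i → p (Fin.suc i))

degree : ∀ {n} → Graph n → Fin n → ℕ
degree G v = count (λ u → adj G v u)

IsThreshold : ∀ {n} → Graph n → (Fin n → ℕ) → Set
IsThreshold G τ = ∀ v → τ v ≤ degree G v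

-- D is a τ-dynamic monopoly: V(G) is partitioned into D₀ = D, D₁, …, D_k,
-- encoded by the part-index map  level : V(G) → {0,…,k}  (v ∈ D_level(v)),
-- such that every v ∈ D_{i+1} has at least τ(v) neighbours in D₀ ∪ … ∪ D_i,
-- i.e. among the vertices of strictly smaller level.
IsDynMono : ∀ {n} → Graph n → (Fin n → ℕ) → Subset n → Set
IsDynMono {n} G τ D =
  Σ ℕ λ k → Σ (Fin n → Fin (suc k)) λ level →
    (∀ v → (level v ≡ Fin.zero) ⇔ (lookup D v ≡ true)) ×
    (∀ v → level v ≡ Fin.zero ⊎ τ v ≤ count (λ u → adj G v u ∧ (toℕ (level u) <ᵇ toℕ (level v))))

IsDyn : ∀ {n} → Graph n → (Fin n → ℕ) → ℕ → Set
IsDyn G τ m =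
  (Σ _ λ D → IsDynMono G τ D × ∣ D ∣ ≡ m) ×
  (∀ D → IsDynMono G τ D → m ≤ ∣ D ∣)

-- Since τ > τ' ≥ 0, every τ-dynamic monopoly D is nonempty: following neighbours
-- of strictly smaller level from any vertex ends in D.  Take a minimum one and
-- w ∈ D.  Then D − w is a τ'-dynamic monopoly: activate w after everything else,
-- when all its neighbours are active (τ'(w) ≤ d(w)), while every other vertex
-- loses at most the one earlier neighbour w, which τ'(v) ≤ τ(v) − 1 pays for.
module Submission where

open import Defs
open import Data.Nat using (ℕ; zero; suc; _+_; _≤_; _<_; _<ᵇ_; z≤n; s≤s)
open import Data.Nat.Properties
  using (≤-refl; ≤-trans; n≤1+n; m≤n⇒m≤1+n; ≤-pred; m<n⇒0<n; +-comm; <ᵇ⇒<; <⇒<ᵇ; module ≤-Reasoning)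
open import Data.Fin using (Fin; toℕ; inject₁; fromℕ; _≟_) renaming (zero to fzero; suc to fsuc)
open import Data.Fin.Properties using (toℕ<n; toℕ-fromℕ; toℕ-inject₁; suc-injective; inject₁-injective)
open import Data.Fin.Subset using (Subset; ∣_∣)
open import Data.Vec using (_∷_; lookup; _[_]≔_)
open import Data.Vec.Properties using (lookup∘update; lookup∘update′)
open import Data.Bool using (Bool; true; false; _∧_)
open import Data.Bool.Properties using (T-≡)
open import Data.Product using (∃; _,_)
open import Data.Sum using (_⊎_; inj₁; inj₂)
open import Data.Empty using (⊥-elim)
open import Relation.Nullary using (Dec; yes; no)
open import Relation.Binary.PropositionalEquality
  using (_≡_; _≢_; refl; trans; cong; subst₂; module ≡-Reasoning)
  renaming (sym to ≡-sym)
open import Function.Base using (_∘_; case_of_)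
open import Function.Bundles using (_⇔_; mk⇔; Equivalence)

count-mono : ∀ {n} (p q : Fin n → Bool) →
  (∀ u → p u ≡ true → q u ≡ true) → count p ≤ count q
count-mono {zero}  p q p⇒q = z≤n
count-mono {suc n} p q p⇒q with p fzero in p0 | q fzero in q0
... | true  | true  = s≤s (count-mono _ _ (λ u → p⇒q (fsuc u)))
... | true  | false with () ← trans (≡-sym q0) (p⇒q fzero p0)
... | false | true  = m≤n⇒m≤1+n (count-mono _ _ (λ u → p⇒q (fsuc u)))
... | false | false = count-mono _ _ (λ u → p⇒q (fsuc u))

count≤1+count-tail : ∀ {n} (p : Fin (suc n) → Bool) → count p ≤ suc (count (λ i → p (fsuc i)))
count≤1+count-tail p with p fzero
... | true  = ≤-refl
... | false = n≤1+n _

count-tail≤count : ∀ {n} (p : Fin (suc n) → Bool) → count (λ i → p (fsuc i)) ≤ count p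
count-tail≤count p with p fzero
... | true  = n≤1+n _
... | false = ≤-refl

count-mono-except : ∀ {n} (p q : Fin n → Bool) (w : Fin n) →
  (∀ u → u ≢ w → p u ≡ true → q u ≡ true) → count p ≤ suc (count q)
count-mono-except {suc n} p q fzero p⇒q = begin
  count p                         ≤⟨ count≤1+count-tail p ⟩
  suc (count (λ i → p (fsuc i)))  ≤⟨ s≤s (count-mono _ _ (λ u → p⇒q (fsuc u) λ ())) ⟩
  suc (count (λ i → q (fsuc i)))  ≤⟨ s≤s (count-tail≤count q) ⟩
  suc (count q)                   ∎
  where open ≤-Reasoning
count-mono-except {suc n} p q (fsuc w) p⇒q
  with p fzero in p0 | q fzero in q0
     | count-mono-except _ _ w (λ u u≢w → p⇒q (fsuc u) (u≢w ∘ suc-injective))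
... | true  | true  | tail = s≤s tail
... | true  | false | _ with () ← trans (≡-sym q0) (p⇒q fzero (λ ()) p0)
... | false | true  | tail = m≤n⇒m≤1+n tail
... | false | false | tail = tail

0<count⇒∃ : ∀ {n} (p : Fin n → Bool) → 0 < count p → ∃ λ u → p u ≡ true
0<count⇒∃ {suc n} p 0<count with p fzero in p0
... | true  = fzero , p0
... | false with 0<count⇒∃ _ 0<count
...   | u , pu = fsuc u , pu

x∈p⇒1+∣p[x]≔false∣≡∣p∣ : ∀ {n} (p : Subset n) (x : Fin n) →
  lookup p x ≡ true → suc ∣ p [ x ]≔ false ∣ ≡ ∣ p ∣
x∈p⇒1+∣p[x]≔false∣≡∣p∣ (true  ∷ p) fzero    refl = refl
x∈p⇒1+∣p[x]≔false∣≡∣p∣ (true  ∷ p) (fsuc x) x∈p  = cong suc (x∈p⇒1+∣p[x]≔false∣≡∣p∣ p x x∈p)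
x∈p⇒1+∣p[x]≔false∣≡∣p∣ (false ∷ p) (fsuc x) x∈p  = x∈p⇒1+∣p[x]≔false∣≡∣p∣ p x x∈p

module _ {n} (G : Graph n) where

  LowerNeighbour : (Fin n → ℕ) → Fin n → Fin n → Bool
  LowerNeighbour rank v u = adj G v u ∧ (rank u <ᵇ rank v)

  lowerDegree : (Fin n → ℕ) → Fin n → ℕ
  lowerDegree rank v = count (LowerNeighbour rank v)

  lower⇒< : ∀ rank v u → LowerNeighbour rank v u ≡ true → rank u < rank v
  lower⇒< rank v u vu∧u<v with adj G v u
  ... | true = <ᵇ⇒< _ _ (Equivalence.from T-≡ vu∧u<v)

  adj∧<⇒lower : ∀ rank v u → adj G v u ≡ true → rank u < rank v →
    LowerNeighbour rank v u ≡ true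
  adj∧<⇒lower rank v u vu u<v rewrite vu = Equivalence.to T-≡ (<⇒<ᵇ u<v)

  adj⇒≢ : ∀ {v u} → adj G v u ≡ true → u ≢ v
  adj⇒≢ {v} vu refl with () ← trans (≡-sym vu) (loopless G v)

  degree≤lowerDegree-of-top : ∀ rank w → (∀ u → u ≢ w → rank u < rank w) →
    degree G w ≤ lowerDegree rank w
  degree≤lowerDegree-of-top rank w top =
    count-mono (adj G w) (LowerNeighbour rank w) λ u wu → adj∧<⇒lower rank w u wu (top u (adj⇒≢ wu))

  lowerDegree-agree-except : ∀ rank rank' w v → (∀ u → u ≢ w → rank u ≡ rank' u) → v ≢ w →
    lowerDegree rank v ≤ suc (lowerDegree rank' v)
  lowerDegree-agree-except rank rank' w v agree v≢w =
    count-mono-except (LowerNeighbour rank v) (LowerNeighbour rank' v) w λ u u≢w lower →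
      subst₂ (λ a b → (adj G v u ∧ (a <ᵇ b)) ≡ true)
        (agree u u≢w) (agree v v≢w) lower

  dynMono-nonempty : ∀ {τ D} → (∀ v → 0 < τ v) → IsDynMono G τ D → Fin n →
    ∃ λ w → lookup D w ≡ true
  dynMono-nonempty {τ} τ>0 (k , level , seed⇔D , activated) v =
    let w , seed = descend (suc k) v (toℕ<n (level v)) in w , Equivalence.to (seed⇔D w) seed
    where
    descend : ∀ j v → toℕ (level v) < j → ∃ λ w → level w ≡ fzero
    descend (suc j) v level<1+j with activated v
    ... | inj₁ seed = v , seed
    ... | inj₂ τ≤lower with 0<count⇒∃ (LowerNeighbour (toℕ ∘ level) v) (≤-trans (τ>0 v) τ≤lower)
    ...   | u , lower = descend j u (≤-trans (lower⇒< (toℕ ∘ level) v u lower) (≤-pred level<1+j))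

module MoveToTop {n k} (w : Fin n) (level : Fin n → Fin (suc k)) where

  level' : Fin n → Fin (suc (suc k))
  level' v with v ≟ w
  ... | yes _ = fromℕ (suc k)
  ... | no  _ = inject₁ (level v)

  level'-≢ : ∀ v → v ≢ w → level' v ≡ inject₁ (level v)
  level'-≢ v v≢w with v ≟ w
  ... | yes v≡w = ⊥-elim (v≢w v≡w)
  ... | no  _   = refl

  level'-top : level' w ≡ fromℕ (suc k)
  level'-top with w ≟ w
  ... | yes _   = refl
  ... | no  w≢w = ⊥-elim (w≢w refl)

  toℕ-level'-≢ : ∀ v → v ≢ w → toℕ (level v) ≡ toℕ (level' v)
  toℕ-level'-≢ v v≢w = begin
    toℕ (level v)           ≡⟨ toℕ-inject₁ (level v) ⟨
    toℕ (inject₁ (level v)) ≡⟨ cong toℕ (level'-≢ v v≢w) ⟨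
    toℕ (level' v)          ∎
    where open ≡-Reasoning

  level'<level'-top : ∀ u → u ≢ w → toℕ (level' u) < toℕ (level' w)
  level'<level'-top u u≢w = begin-strict
    toℕ (level' u)       ≡⟨ toℕ-level'-≢ u u≢w ⟨
    toℕ (level u)        <⟨ toℕ<n (level u) ⟩
    suc k                ≡⟨ toℕ-fromℕ (suc k) ⟨
    toℕ (fromℕ (suc k))  ≡⟨ cong toℕ level'-top ⟨
    toℕ (level' w)       ∎
    where open ≤-Reasoning

dynMono-remove : ∀ {n} (G : Graph n) {τ τ' D} (w : Fin n) →
  τ' w ≤ degree G w → (∀ v → τ' v < τ v) →
  IsDynMono G τ D → IsDynMono G τ' (D [ w ]≔ false)
dynMono-remove G {τ} {τ'} {D} w τ'w≤deg τ'<τ (k , level , seed⇔D , activated) =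
  suc k , level' , seed'⇔D' , activated'
  where
  open MoveToTop w level

  seed'⇔D' : ∀ v → (level' v ≡ fzero) ⇔ (lookup (D [ w ]≔ false) v ≡ true)
  seed'⇔D' v = split (v ≟ w)
    where
    split : Dec (v ≡ w) → (level' v ≡ fzero) ⇔ (lookup (D [ w ]≔ false) v ≡ true)
    split (yes refl) = mk⇔
      (λ seed → case trans (≡-sym level'-top) seed of λ ())
      (λ w∈D' → case trans (≡-sym (lookup∘update w D false)) w∈D' of λ ())
    split (no v≢w) = mk⇔
      (λ seed → trans (lookup∘update′ v≢w D false)
        (Equivalence.to (seed⇔D v) (inject₁-injective (trans (≡-sym (level'-≢ v v≢w)) seed))))
      (λ v∈D' → trans (level'-≢ v v≢w)
        (cong inject₁ (Equivalence.from (seed⇔D v) (trans (≡-sym (lookup∘update′ v≢w D false)) v∈D'))))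

  activated' : ∀ v → level' v ≡ fzero ⊎ τ' v ≤ lowerDegree G (toℕ ∘ level') v
  activated' v = split (v ≟ w) (activated v)
    where
    split : Dec (v ≡ w) → level v ≡ fzero ⊎ τ v ≤ lowerDegree G (toℕ ∘ level) v →
      level' v ≡ fzero ⊎ τ' v ≤ lowerDegree G (toℕ ∘ level') v
    split (yes refl) _ = inj₂ (≤-trans τ'w≤deg
      (degree≤lowerDegree-of-top G (toℕ ∘ level') w level'<level'-top))
    split (no v≢w) (inj₁ seed) = inj₁ (trans (level'-≢ v v≢w) (cong inject₁ seed))
    split (no v≢w) (inj₂ τ≤lower) = inj₂ (≤-pred (≤-trans (τ'<τ v) (≤-trans τ≤lower
      (lowerDegree-agree-except G (toℕ ∘ level) (toℕ ∘ level') w v toℕ-level'-≢ v≢w))))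

lemma1 : ∀ {n} (G : Graph (suc n)) (τ τ' : Fin (suc n) → ℕ) →
    IsThreshold G τ → IsThreshold G τ' →
    (∀ v → τ' v < τ v) →
    ∀ m m' → IsDyn G τ m → IsDyn G τ' m' → m' + 1 ≤ m
lemma1 G τ τ' _ τ'-threshold τ'<τ m m' ((D , D-dynMono , ∣D∣≡m) , _) (_ , m'-minimal)
  with dynMono-nonempty G {D = D} (m<n⇒0<n ∘ τ'<τ) D-dynMono fzero
... | w , w∈D = begin
  m' + 1                   ≡⟨ +-comm m' 1 ⟩
  suc m'                   ≤⟨ s≤s (m'-minimal (D [ w ]≔ false) D'-dynMono) ⟩
  suc ∣ D [ w ]≔ false ∣   ≡⟨ x∈p⇒1+∣p[x]≔false∣≡∣p∣ D w w∈D ⟩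
  ∣ D ∣                    ≡⟨ ∣D∣≡m ⟩
  m                        ∎
  where
  open ≤-Reasoning
  D'-dynMono : IsDynMono G τ' (D [ w ]≔ false)
  D'-dynMono = dynMono-remove G {D = D} w (τ'-threshold w) τ'<τ D-dynMono
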